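{- Let $G=(V,E)$ be a graph without isolated vertices and let $M$ be the set of vertices of $G$ that are the middle vertex of some induced $P_3$ in $G$. If $\{C_1,C_2\}$ is a sigma clique cover of $G$ with $C_1\not\subseteq C_2$ and $C_2\not\subseteq C_1$, then $M=C_1\cap C_2$.
   Context: Graphs are finite, simple, undirected; $P_3$ is the path on three vertices (its middle vertex is the one of degree two). A sigma clique cover of $G$ is a family $\mathcal{C}$ of vertex subsets such that $G[C]$ is a clique for every $C\in\mathcal{C}$ and every edge of $G$ has both endpoints in some $C\in\mathcal{C}$. -}

module Defs where

open import Data.Nat using (ℕ)
open import Data.Fin using (Fin)
open import Data.Product using (Σ; ∃; ∃-syntax; _×_; _,_)
open import Data.Sum using (_⊎_)
open import Relation.Nullary using (¬_)
open import Relation.Binary.PropositionalEquality using (_≡_; _≢_)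
open import Relation.Nullary using (Dec)
open import Data.Fin.Subset using (Subset; _∈_)

record Graph (n : ℕ) : Set₁ where
  field
    Adj     : Fin n → Fin n → Set
    sym     : ∀ {u v} → Adj u v → Adj v u
    irrefl  : ∀ {v} → ¬ Adj v v
    adj?    : ∀ u v → Dec (Adj u v)

open Graph public

VSet : ℕ → Set
VSet n = Subset n

NoIsolated : ∀ {n} → Graph n → Set
NoIsolated {n} G = ∀ (v : Fin n) → ∃[ u ] Adj G v u

IsP3Middle : ∀ {n} → Graph n → Fin n → Set
IsP3Middle G v =
  ∃[ a ] ∃[ b ] (a ≢ b × Adj G a v × Adj G v b × ¬ Adj G a b)

IsClique : ∀ {n} → Graph n → VSet n → Set
IsClique G C = ∀ {u v} → u ∈ C → v ∈ C → u ≢ v → Adj G u v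

IsSigmaCliqueCover₂ : ∀ {n} → Graph n → VSet n → VSet n → Set
IsSigmaCliqueCover₂ G C₁ C₂ =
  IsClique G C₁ × IsClique G C₂ ×
  (∀ {u v} → Adj G u v → (u ∈ C₁ × v ∈ C₁) ⊎ (u ∈ C₂ × v ∈ C₂))

{-# OPTIONS --safe #-}
module Submission where

open import Defs
open import Data.Fin using (Fin)
open import Data.Product using (_×_; _,_; ∃-syntax)
open import Data.Sum using (inj₁; inj₂)
open import Relation.Nullary using (¬_; contradiction)
open import Relation.Nullary.Decidable using (_→-dec_; decidable-stable)
open import Relation.Binary.PropositionalEquality using (refl)
open import Data.Fin.Subset using (Subset; _⊆_; _⊈_; _∈_; _∉_)
open import Data.Fin.Subset.Properties using (_∈?_)
open import Data.Fin.Properties using (¬∀⟶∃¬)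

-- The middle vertex v of an induced P₃ a – v – b cannot lie in a clique together
-- with both a and b, so its two edges are covered by different cliques.
-- Conversely, for v ∈ C₁ ∩ C₂, any a ∈ C₁ ∖ C₂ and b ∈ C₂ ∖ C₁ are adjacent to v
-- but not to each other, because no clique of the cover contains both.

⊈⇒∃∈∉ : ∀ {n} {A B : Subset n} → A ⊈ B → ∃[ x ] (x ∈ A × x ∉ B)
⊈⇒∃∈∉ {n} {A} {B} A⊈B
  with ¬∀⟶∃¬ n (λ x → x ∈ A → x ∈ B) (λ x → (x ∈? A) →-dec (x ∈? B)) (λ A⊆B → A⊈B (A⊆B _))
... | x , x∈A⇏x∈B =
  x , decidable-stable (x ∈? A) (λ x∉A → x∈A⇏x∈B (λ x∈A → contradiction x∈A x∉A))
    , (λ x∈B → x∈A⇏x∈B (λ _ → x∈B))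

module _ {n} {G : Graph n} {C₁ C₂ : VSet n} where

  P3Middle⇒∈∩ : IsSigmaCliqueCover₂ G C₁ C₂ → ∀ {v} → IsP3Middle G v → v ∈ C₁ × v ∈ C₂
  P3Middle⇒∈∩ (K₁ , K₂ , covers) (a , b , a≢b , av , vb , ¬ab)
    with covers av | covers vb
  ... | inj₁ (a∈C₁ , _) | inj₁ (_ , b∈C₁) = contradiction (K₁ a∈C₁ b∈C₁ a≢b) ¬ab
  ... | inj₂ (a∈C₂ , _) | inj₂ (_ , b∈C₂) = contradiction (K₂ a∈C₂ b∈C₂ a≢b) ¬ab
  ... | inj₁ (_ , v∈C₁) | inj₂ (v∈C₂ , _) = v∈C₁ , v∈C₂
  ... | inj₂ (_ , v∈C₂) | inj₁ (v∈C₁ , _) = v∈C₁ , v∈C₂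

  ∉∉⇒nonadjacent : IsSigmaCliqueCover₂ G C₁ C₂ → ∀ {a b} → a ∉ C₂ → b ∉ C₁ → ¬ Adj G a b
  ∉∉⇒nonadjacent (_ , _ , covers) a∉C₂ b∉C₁ ab with covers ab
  ... | inj₁ (_ , b∈C₁) = b∉C₁ b∈C₁
  ... | inj₂ (a∈C₂ , _) = a∉C₂ a∈C₂

  ∈∩⇒P3Middle : IsSigmaCliqueCover₂ G C₁ C₂ → C₁ ⊈ C₂ → C₂ ⊈ C₁ →
                ∀ {v} → v ∈ C₁ → v ∈ C₂ → IsP3Middle G v
  ∈∩⇒P3Middle cover@(K₁ , K₂ , _) C₁⊈C₂ C₂⊈C₁ v∈C₁ v∈C₂
    with ⊈⇒∃∈∉ C₁⊈C₂ | ⊈⇒∃∈∉ C₂⊈C₁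
  ... | a , a∈C₁ , a∉C₂ | b , b∈C₂ , b∉C₁ =
    a , b
      , (λ { refl → b∉C₁ a∈C₁ })
      , K₁ a∈C₁ v∈C₁ (λ { refl → a∉C₂ v∈C₂ })
      , K₂ v∈C₂ b∈C₂ (λ { refl → b∉C₁ v∈C₁ })
      , ∉∉⇒nonadjacent cover a∉C₂ b∉C₁

mainTheorem17 : ∀ {n} (G : Graph n) (C₁ C₂ : VSet n) →
    NoIsolated G →
    IsSigmaCliqueCover₂ G C₁ C₂ →
    ¬ (C₁ ⊆ C₂) → ¬ (C₂ ⊆ C₁) →
    ∀ (v : Fin n) → (IsP3Middle G v → v ∈ C₁ × v ∈ C₂) × (v ∈ C₁ × v ∈ C₂ → IsP3Middle G v)
mainTheorem17 G C₁ C₂ _ cover C₁⊈C₂ C₂⊈C₁ v =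
    P3Middle⇒∈∩ {G = G} cover
  , λ (v∈C₁ , v∈C₂) → ∈∩⇒P3Middle {G = G} cover C₁⊈C₂ C₂⊈C₁ v∈C₁ v∈C₂
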